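{- For any $S\in 2^\Sigma$ and atomic assertions $Q_1,\ldots,Q_n$ (with $n\ge 1$): \[S\not\vDash Q_1\oplus\cdots\oplus Q_n\quad\text{iff}\quad \exists i.\ S\vDash\overline{Q}_i\quad\text{or}\quad S\vDash(\overline{Q}_1\land\cdots\land\overline{Q}_n)\oplus\top\quad\text{or}\quad S\vDash\top^\oplus.\]
   Context: $\Sigma$ is a set of program states and $\mathsf{Prop}$ a set of atomic assertions with a relation $\vDash_\Sigma\subseteq\Sigma\times\mathsf{Prop}$; $\mathsf{Prop}$ is closed under a negation $\overline{Q}$ with $\sigma\vDash_\Sigma\overline{Q}$ iff $\sigma\not\vDash_\Sigma Q$. Assertions are interpreted over sets $S\subseteq\Sigma$: $S\vDash\top$ always; $S\vDash\top^\oplus$ iff $S=\emptyset$; $S\vDash\varphi\land\psi$ iff both; $S\vDash\varphi\oplus\psi$ iff $S=S_1\cup S_2$ with $S_1\vDash\varphi$ and $S_2\vDash\psi$; for an atomic $P$, $S\vDash P$ iff $S\neq\emptyset$ and $\sigma\vDash_\Sigma P$ for all $\sigma\in S$. -}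

module Defs where

open import Level using (0ℓ; Lift) renaming (suc to lsuc)
open import Data.Nat using (ℕ; suc)
open import Data.Fin using (Fin; zero; suc)
open import Data.Product using (Σ; ∃; _×_; _,_)
open import Data.Sum using (_⊎_)
open import Data.Unit using (⊤)
open import Relation.Nullary using (¬_)
open import Function.Bundles using (_⇔_)

record Setting : Set₁ where
  field
    State  : Set
    Prop   : Set
    _⊨Σ_   : State → Prop → Set
    neg    : Prop → Prop
    neg-sat : ∀ σ Q → (σ ⊨Σ neg Q) ⇔ (¬ (σ ⊨Σ Q))

module _ (𝒮 : Setting) where
  open Setting 𝒮

  StateSet : Set₁
  StateSet = State → Set

  data Assertion : Set where
    ⊤a  : Assertion
    ⊤⊕  : Assertion
    atom : Prop → Assertion
    _∧a_ : Assertion → Assertion → Assertion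
    _⊕a_ : Assertion → Assertion → Assertion

  infixr 6 _∧a_
  infixr 5 _⊕a_

  _⊨_ : StateSet → Assertion → Set₁
  S ⊨ ⊤a       = Lift (lsuc 0ℓ) ⊤
  S ⊨ ⊤⊕       = Lift (lsuc 0ℓ) (∀ σ → ¬ S σ)
  S ⊨ atom P   = Lift (lsuc 0ℓ) ((∃ λ σ → S σ) × (∀ σ → S σ → σ ⊨Σ P))
  S ⊨ (φ ∧a ψ) = (S ⊨ φ) × (S ⊨ ψ)
  S ⊨ (φ ⊕a ψ) = Σ StateSet λ S₁ → Σ StateSet λ S₂ →
                   (∀ σ → S σ ⇔ (S₁ σ ⊎ S₂ σ)) × (S₁ ⊨ φ) × (S₂ ⊨ ψ)

  bigOplus : ∀ n → (Fin (suc n) → Prop) → Assertion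
  bigOplus ℕ.zero Q = atom (Q zero)
  bigOplus (suc n) Q = atom (Q zero) ⊕a bigOplus n (λ i → Q (suc i))

  bigAndNeg : ∀ n → (Fin (suc n) → Prop) → Assertion
  bigAndNeg ℕ.zero Q = atom (neg (Q zero))
  bigAndNeg (suc n) Q = atom (neg (Q zero)) ∧a bigAndNeg n (λ i → Q (suc i))

-- Write Rᵢ for the set of states satisfying Qᵢ. S ⊨ Q₁ ⊕ ⋯ ⊕ Qₙ says exactly
-- that S meets every Rᵢ and is covered by R₁ ∪ ⋯ ∪ Rₙ. Classically this fails
-- iff some Rᵢ misses S (then S ⊨ Q̄ᵢ, or S = ∅), or some state of S lies in
-- no Rᵢ (then the singleton of that state witnesses (Q̄₁ ∧ ⋯ ∧ Q̄ₙ) ⊕ ⊤).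
module Submission where

open import Defs
open import Level using (0ℓ; Lift; lift; lower) renaming (suc to lsuc)
open import Data.Nat using (ℕ; zero; suc)
open import Data.Fin using (Fin; zero; suc)
open import Data.Fin.Properties using (∀-cons-⇔; ∃-toSum)
open import Data.Product using (Σ; ∃; _×_; _,_; proj₁; proj₂; map₂)
import Data.Product as Product
open import Data.Product.Function.NonDependent.Propositional using (_×-⇔_)
open import Data.Sum using (_⊎_; inj₁; inj₂; [_,_])
import Data.Sum as Sum
open import Data.Sum.Function.Propositional using (_⊎-⇔_)
open import Data.Unit using (tt)
open import Function using (_∘_; id; _$_)
open import Function.Bundles using (_⇔_; mk⇔; Equivalence)
open import Function.Construct.Composition using (_⇔-∘_)
open import Function.Construct.Identity using (⇔-id)
open import Function.Construct.Symmetry using (⇔-sym)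
open import Function.Related.TypeIsomorphisms using (¬-cong-⇔)
open import Relation.Nullary using (¬_; yes; no)
open import Relation.Nullary.Decidable using (map′)
open import Relation.Binary.PropositionalEquality using (_≡_; refl)
open import Axiom.ExcludedMiddle using (ExcludedMiddle)
open import Axiom.DoubleNegationElimination using (em⇒dne)
open Equivalence using (to; from)
open Setting using (Prop; neg)

lower-em : ExcludedMiddle (lsuc 0ℓ) → ExcludedMiddle 0ℓ
lower-em em {A} = map′ lower lift (em {Lift (lsuc 0ℓ) A})

module _ {X I : Set} (S : X → Set) (R : X → I → Set) where

  Hits : Set
  Hits = ∀ i → ∃ λ x → S x × R x i

  Covers : Set
  Covers = ∀ x → S x → ∃ (R x)

  Obstruction : Set
  Obstruction = (∃ λ i → ∃ S × (∀ x → S x → ¬ R x i))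
              ⊎ (∃ λ x → S x × (∀ i → ¬ R x i))
              ⊎ (∀ x → ¬ S x)

  obstruction⇒¬hits×covers : I → Obstruction → ¬ (Hits × Covers)
  obstruction⇒¬hits×covers _ (inj₁ (i , _ , ¬R)) (hits , _) =
    let (x , s , r) = hits i in ¬R x s r
  obstruction⇒¬hits×covers _ (inj₂ (inj₁ (x , s , ¬R))) (_ , covers) =
    let (i , r) = covers x s in ¬R i r
  obstruction⇒¬hits×covers i₀ (inj₂ (inj₂ empty)) (hits , _) =
    let (x , s , _) = hits i₀ in empty x s

  ¬hits×covers⇒obstruction : ExcludedMiddle 0ℓ → ¬ (Hits × Covers) → Obstruction
  ¬hits×covers⇒obstruction em ¬hc with em {∃ λ x → S x × (∀ i → ¬ R x i)}
  ... | yes uncovered = inj₂ (inj₁ uncovered)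
  ... | no covered with em {∃ S}
  ...   | no empty = inj₂ (inj₂ λ x s → empty (x , s))
  ...   | yes nonempty = inj₁ (Product.map id (nonempty ,_) missed)
    where
    dne : {P : Set} → ¬ ¬ P → P
    dne = em⇒dne em

    covers : Covers
    covers x s = dne λ ¬∃ → covered (x , s , λ i r → ¬∃ (i , r))

    missed : ∃ λ i → ∀ x → S x → ¬ R x i
    missed = dne λ ¬∃ →
      ¬hc ((λ i → dne λ ¬hit → ¬∃ (i , λ x s r → ¬hit (x , s , r))) , covers)

  ¬hits×covers⇔obstruction : ExcludedMiddle 0ℓ → I → (¬ (Hits × Covers)) ⇔ Obstruction
  ¬hits×covers⇔obstruction em i₀ =
    mk⇔ (¬hits×covers⇒obstruction em) (obstruction⇒¬hits×covers i₀)

module _ (𝒮 : Setting) where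
  open Setting 𝒮 hiding (Prop; neg)

  Sat : {I : Set} → (I → Prop 𝒮) → State → I → Set
  Sat Q σ i = σ ⊨Σ Q i

  ⊨bigOplus⇒ : ∀ n Q (T : StateSet 𝒮) →
               _⊨_ 𝒮 T (bigOplus 𝒮 n Q) → Hits T (Sat Q) × Covers T (Sat Q)
  ⊨bigOplus⇒ zero Q T (lift ((σ , t) , sat)) =
    (λ { zero → σ , t , sat σ t }) , λ σ t → zero , sat σ t
  ⊨bigOplus⇒ (suc n) Q T (T₁ , T₂ , T⇔T₁∪T₂ , lift ((σ , t₁) , sat) , rest) =
    hits , covers
    where
    hits₂×covers₂ : Hits T₂ (Sat (Q ∘ suc)) × Covers T₂ (Sat (Q ∘ suc))
    hits₂×covers₂ = ⊨bigOplus⇒ n (Q ∘ suc) T₂ rest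

    hits : Hits T (Sat Q)
    hits zero = σ , from (T⇔T₁∪T₂ σ) (inj₁ t₁) , sat σ t₁
    hits (suc i) =
      let (τ , t₂ , q) = proj₁ hits₂×covers₂ i in τ , from (T⇔T₁∪T₂ τ) (inj₂ t₂) , q

    covers : Covers T (Sat Q)
    covers τ t = [ (λ t₁ → zero , sat τ t₁)
                 , (λ t₂ → Product.map suc id (proj₂ hits₂×covers₂ τ t₂)) ]
                 (to (T⇔T₁∪T₂ τ) t)

  hits×covers⇒⊨bigOplus : ∀ n Q (T : StateSet 𝒮) →
                          Hits T (Sat Q) → Covers T (Sat Q) → _⊨_ 𝒮 T (bigOplus 𝒮 n Q)
  hits×covers⇒⊨bigOplus zero Q T hits covers =
    lift ((Product.map id proj₁ (hits zero)) , λ σ t → only-zero (covers σ t))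
    where
    only-zero : ∀ {σ} → ∃ (Sat Q σ) → σ ⊨Σ Q zero
    only-zero (zero , q) = q
  hits×covers⇒⊨bigOplus (suc n) Q T hits covers =
    T₁ , T₂ , T⇔T₁∪T₂ ,
    lift (hits zero , λ _ → proj₂) ,
    hits×covers⇒⊨bigOplus n (Q ∘ suc) T₂ hits₂ (λ _ → proj₂)
    where
    T₁ T₂ : StateSet 𝒮
    T₁ σ = T σ × σ ⊨Σ Q zero
    T₂ σ = T σ × ∃ (Sat (Q ∘ suc) σ)

    T⇔T₁∪T₂ : ∀ σ → T σ ⇔ (T₁ σ ⊎ T₂ σ)
    T⇔T₁∪T₂ σ = mk⇔ (λ t → Sum.map (t ,_) (t ,_) (∃-toSum (covers σ t)))
                    [ proj₁ , proj₁ ]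

    hits₂ : Hits T₂ (Sat (Q ∘ suc))
    hits₂ i = let (σ , t , q) = hits (suc i) in σ , (t , i , q) , q

  ⊨bigOplus⇔ : ∀ n Q (T : StateSet 𝒮) →
               _⊨_ 𝒮 T (bigOplus 𝒮 n Q) ⇔ (Hits T (Sat Q) × Covers T (Sat Q))
  ⊨bigOplus⇔ n Q T =
    mk⇔ (⊨bigOplus⇒ n Q T) (λ (hits , covers) → hits×covers⇒⊨bigOplus n Q T hits covers)

  ⊨atom-neg⇔ : ∀ (T : StateSet 𝒮) P →
               _⊨_ 𝒮 T (atom (neg 𝒮 P)) ⇔ (∃ T × (∀ σ → T σ → ¬ σ ⊨Σ P))
  ⊨atom-neg⇔ T P =
    mk⇔ (λ (lift (ne , h)) → ne , λ σ t → to (neg-sat σ P) (h σ t))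
        (λ (ne , h) → lift (ne , λ σ t → from (neg-sat σ P) (h σ t)))

  ⊨bigAndNeg⇔ : ∀ n Q (T : StateSet 𝒮) →
                _⊨_ 𝒮 T (bigAndNeg 𝒮 n Q) ⇔ (∀ i → _⊨_ 𝒮 T (atom (neg 𝒮 (Q i))))
  ⊨bigAndNeg⇔ zero Q T = mk⇔ (λ { a zero → a }) (_$ zero)
  ⊨bigAndNeg⇔ (suc n) Q T =
    ∀-cons-⇔ {P = λ i → _⊨_ 𝒮 T (atom (neg 𝒮 (Q i)))}
    ⇔-∘ (⇔-id _ ×-⇔ ⊨bigAndNeg⇔ n (Q ∘ suc) T)

  ⊨bigAndNeg⊕⊤⇔ : ∀ n Q (T : StateSet 𝒮) →
                  _⊨_ 𝒮 T (bigAndNeg 𝒮 n Q ⊕a ⊤a) ⇔ (∃ λ σ → T σ × (∀ i → ¬ σ ⊨Σ Q i))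
  ⊨bigAndNeg⊕⊤⇔ n Q T = mk⇔ uncovered-state singleton-split
    where
    ¬Q-on : ∀ {T₁ : StateSet 𝒮} → _⊨_ 𝒮 T₁ (bigAndNeg 𝒮 n Q) →
            ∀ i → ∃ T₁ × (∀ σ → T₁ σ → ¬ σ ⊨Σ Q i)
    ¬Q-on {T₁} a i = to (⊨atom-neg⇔ T₁ (Q i)) (to (⊨bigAndNeg⇔ n Q T₁) a i)

    uncovered-state : _⊨_ 𝒮 T (bigAndNeg 𝒮 n Q ⊕a ⊤a) → ∃ λ σ → T σ × (∀ i → ¬ σ ⊨Σ Q i)
    uncovered-state (_ , _ , T⇔T₁∪T₂ , a , _) =
      let (σ , t₁) = proj₁ (¬Q-on a zero)
      in σ , from (T⇔T₁∪T₂ σ) (inj₁ t₁) , λ i → proj₂ (¬Q-on a i) σ t₁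

    singleton-split : (∃ λ σ → T σ × (∀ i → ¬ σ ⊨Σ Q i)) → _⊨_ 𝒮 T (bigAndNeg 𝒮 n Q ⊕a ⊤a)
    singleton-split (σ , t , ¬Q) =
      (_≡ σ) , T , (λ τ → mk⇔ inj₂ [ (λ { refl → t }) , id ]) ,
      from (⊨bigAndNeg⇔ n Q (_≡ σ))
           (λ i → from (⊨atom-neg⇔ (_≡ σ) (Q i)) ((σ , refl) , λ { _ refl → ¬Q i })) ,
      lift tt

  obstruction⇔ : ∀ n Q (T : StateSet 𝒮) →
    Obstruction T (Sat Q) ⇔
      ((Σ (Fin (suc n)) λ i → _⊨_ 𝒮 T (atom (neg 𝒮 (Q i))))
       ⊎ _⊨_ 𝒮 T (bigAndNeg 𝒮 n Q ⊕a ⊤a)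
       ⊎ _⊨_ 𝒮 T ⊤⊕)
  obstruction⇔ n Q T =
    mk⇔ (map₂ (from (⊨atom-neg⇔ T (Q _)))) (map₂ (to (⊨atom-neg⇔ T (Q _))))
    ⊎-⇔ ⇔-sym (⊨bigAndNeg⊕⊤⇔ n Q T)
    ⊎-⇔ mk⇔ lift lower

lemma5p5 : ExcludedMiddle (lsuc 0ℓ) →
    (𝒮 : Setting) (S : StateSet 𝒮) (n : ℕ) (Q : Fin (suc n) → Prop 𝒮) →
    (¬ _⊨_ 𝒮 S (bigOplus 𝒮 n Q)) ⇔
      ((Σ (Fin (suc n)) λ i → _⊨_ 𝒮 S (atom (neg 𝒮 (Q i))))
       ⊎ _⊨_ 𝒮 S (_⊕a_ (bigAndNeg 𝒮 n Q) ⊤a)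
       ⊎ _⊨_ 𝒮 S ⊤⊕)
lemma5p5 em 𝒮 S n Q =
  obstruction⇔ 𝒮 n Q S
  ⇔-∘ (¬hits×covers⇔obstruction S (Sat 𝒮 Q) (lower-em em) zero
  ⇔-∘ ¬-cong-⇔ (⊨bigOplus⇔ 𝒮 n Q S))
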